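{- The Riordan array $(c(x)^2, -x\,c(x)^3)$ is a Riordan involution, i.e. its square equals the identity $(1,x)$. -}

module Defs where

open import Data.Nat as ℕ using (ℕ; zero; suc)
open import Data.Nat.Combinatorics using (_C_)
open import Data.Integer using (ℤ; +_; _+_; _*_; -_; 0ℤ; 1ℤ)

-- Formal power series over ℤ, represented by their coefficient sequences.
PS : Set
PS = ℕ → ℤ

sumTo : ℕ → (ℕ → ℤ) → ℤ
sumTo zero    a = a 0
sumTo (suc n) a = sumTo n a + a (suc n)

_⊛_ : PS → PS → PS
(a ⊛ b) n = sumTo n (λ i → a i * b (n ℕ.∸ i))

infixl 7 _⊛_

onePS : PS
onePS zero    = 1ℤ
onePS (suc _) = 0ℤ

negPS : PS → PS
negPS a n = - a n

xTimes : PS → PS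
xTimes a zero    = 0ℤ
xTimes a (suc n) = a n

_^ᵖ_ : PS → ℕ → PS
a ^ᵖ zero  = onePS
a ^ᵖ suc k = a ⊛ (a ^ᵖ k)

catalan : ℕ → ℕ
catalan n = ((2 ℕ.* n) C n) ℕ./ suc n

c : PS
c n = + catalan n

riordan : PS → PS → ℕ → ℕ → ℤ
riordan g f n k = (g ⊛ (f ^ᵖ k)) n

gC : PS
gC = c ⊛ c

fC : PS
fC = negPS (xTimes (c ⊛ c ⊛ c))

R : ℕ → ℕ → ℤ
R = riordan gC fC

-- matrix product of lower-triangular matrices: (A B)_{n,k} = Σ_{j=0}^{n} A_{n,j} B_{j,k}
-- (terms with j > n vanish since A is lower triangular)
matMul : (ℕ → ℕ → ℤ) → (ℕ → ℕ → ℤ) → ℕ → ℕ → ℤ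
matMul A B n k = sumTo n (λ j → A n j * B j k)

-- Riordan arrays multiply by (g, h)·(G, F) = (g·G(h), F(h)) whenever h has no
-- constant term, so it suffices to show  f(f) = x  and  g·g(f) = 1  for
-- g = c², f = -x·c³.  Both follow from one identity: c(f) = 1 - x·c.  Indeed
-- c(f) and w = 1 - x·c both solve z = 1 + f·z², whose solution is unique, and
-- c·w = 1 by the Catalan equation c = 1 + x·c²; then f(f) = x·(c·w)³ and
-- g·g(f) = (c·w)².

module Submission where

open import Defs
open import Data.Nat as ℕ using (ℕ; zero; suc; z≤n; s≤s; _∸_; _!)
import Data.Nat.Properties as ℕP
open import Data.Integer using (ℤ; +_; _+_; _*_; -_; 0ℤ; 1ℤ)
import Data.Integer.Properties as ℤP
import Data.Integer.Tactic.RingSolver as ℤ-Solver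
import Data.Nat.Tactic.RingSolver as ℕ-Solver
open import Data.Nat.Combinatorics
  using (_C_; nCk≡n!/k![n-k]!; k![n∸k]!∣n!; [n-k]*[n-k-1]!≡[n-k]!; nCk≡nC[n∸k]; nCk+nC[k+1]≡[n+1]C[k+1])
open import Data.Nat.DivMod using (_/_; m/n*n≡m; m*n/n≡m)
open import Algebra.Bundles using (CommutativeRing)
open import Algebra.Structures using (IsCommutativeRing)
import Algebra.Solver.Ring
import Algebra.Solver.Ring.AlmostCommutativeRing as ACR
open import Data.Maybe using (Maybe; just; nothing)
import Relation.Binary.Reasoning.Setoid
open import Relation.Nullary using (yes; no)
open import Data.Product using (_,_)
open import Data.Sum using (inj₁; inj₂)
open import Function using (_∘_)
open import Relation.Binary.PropositionalEquality

sum-cong : ∀ n {f g : ℕ → ℤ} → (∀ i → i ℕ.≤ n → f i ≡ g i) → sumTo n f ≡ sumTo n g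
sum-cong zero    f≡g = f≡g 0 z≤n
sum-cong (suc n) f≡g =
  cong₂ _+_ (sum-cong n (λ i i≤n → f≡g i (ℕP.m≤n⇒m≤1+n i≤n))) (f≡g (suc n) ℕP.≤-refl)

sum-cong′ : ∀ n {f g : ℕ → ℤ} → (∀ i → f i ≡ g i) → sumTo n f ≡ sumTo n g
sum-cong′ n f≡g = sum-cong n (λ i _ → f≡g i)

sum-zero : ∀ n (f : ℕ → ℤ) → (∀ i → i ℕ.≤ n → f i ≡ 0ℤ) → sumTo n f ≡ 0ℤ
sum-zero zero    f f≡0 = f≡0 0 z≤n
sum-zero (suc n) f f≡0 =
  cong₂ _+_ (sum-zero n f (λ i i≤n → f≡0 i (ℕP.m≤n⇒m≤1+n i≤n))) (f≡0 (suc n) ℕP.≤-refl)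

sum-+ : ∀ n (f g : ℕ → ℤ) → sumTo n (λ i → f i + g i) ≡ sumTo n f + sumTo n g
sum-+ zero    f g = refl
sum-+ (suc n) f g = trans (cong (_+ (f (suc n) + g (suc n))) (sum-+ n f g))
                          (interchange (sumTo n f) (sumTo n g) (f (suc n)) (g (suc n)))
  where
  interchange : ∀ a b c d → (a + b) + (c + d) ≡ (a + c) + (b + d)
  interchange = ℤ-Solver.solve-∀

sum-*ˡ : ∀ n a (f : ℕ → ℤ) → a * sumTo n f ≡ sumTo n (λ i → a * f i)
sum-*ˡ zero    a f = refl
sum-*ˡ (suc n) a f = trans (ℤP.*-distribˡ-+ a (sumTo n f) (f (suc n)))
                           (cong (_+ a * f (suc n)) (sum-*ˡ n a f))

sum-*ʳ : ∀ n a (f : ℕ → ℤ) → sumTo n f * a ≡ sumTo n (λ i → f i * a)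
sum-*ʳ n a f = trans (ℤP.*-comm (sumTo n f) a)
                     (trans (sum-*ˡ n a f) (sum-cong′ n (λ i → ℤP.*-comm a (f i))))

sum-neg : ∀ n (f : ℕ → ℤ) → - sumTo n f ≡ sumTo n (λ i → - f i)
sum-neg zero    f = refl
sum-neg (suc n) f = trans (ℤP.neg-distrib-+ (sumTo n f) (f (suc n)))
                          (cong (_+ - f (suc n)) (sum-neg n f))

sum-head : ∀ n (f : ℕ → ℤ) → sumTo (suc n) f ≡ f 0 + sumTo n (f ∘ suc)
sum-head zero    f = refl
sum-head (suc n) f = trans (cong (_+ f (suc (suc n))) (sum-head n f))
                           (ℤP.+-assoc (f 0) (sumTo n (f ∘ suc)) (f (suc (suc n))))

sum-truncate : ∀ {m n} (f : ℕ → ℤ) → m ℕ.≤ n →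
               (∀ i → m ℕ.< i → i ℕ.≤ n → f i ≡ 0ℤ) → sumTo n f ≡ sumTo m f
sum-truncate {n = zero}  f z≤n tail≡0 = refl
sum-truncate {m} {suc n} f m≤1+n tail≡0 with ℕP.m≤n⇒m<n∨m≡n m≤1+n
... | inj₂ refl        = refl
... | inj₁ (s≤s m≤n) =
  trans (cong₂ _+_ (sum-truncate f m≤n (λ i m<i i≤n → tail≡0 i m<i (ℕP.m≤n⇒m≤1+n i≤n)))
                   (tail≡0 (suc n) (s≤s m≤n) ℕP.≤-refl))
        (ℤP.+-identityʳ (sumTo m f))

sum-reverse : ∀ n (f : ℕ → ℤ) → sumTo n f ≡ sumTo n (λ i → f (n ∸ i))
sum-reverse zero    f = refl
sum-reverse (suc n) f = begin
    sumTo (suc n) f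
  ≡⟨ sum-head n f ⟩
    f 0 + sumTo n (f ∘ suc)
  ≡⟨ cong (λ s → f 0 + s) (sum-reverse n (f ∘ suc)) ⟩
    f 0 + sumTo n (λ i → f (suc (n ∸ i)))
  ≡⟨ ℤP.+-comm (f 0) _ ⟩
    sumTo n (λ i → f (suc (n ∸ i))) + f 0
  ≡⟨ cong₂ _+_ (sum-cong n (λ i i≤n → cong f (sym (ℕP.+-∸-assoc 1 i≤n))))
               (cong f (sym (ℕP.n∸n≡0 n))) ⟩
    sumTo (suc n) (λ i → f (suc n ∸ i))
  ∎
  where open ≡-Reasoning

sum-swap : ∀ n m (F : ℕ → ℕ → ℤ) →
           sumTo n (λ i → sumTo m (F i)) ≡ sumTo m (λ j → sumTo n (λ i → F i j))
sum-swap zero    m F = refl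
sum-swap (suc n) m F = trans (cong (_+ sumTo m (F (suc n))) (sum-swap n m F))
                             (sym (sum-+ m (λ j → sumTo n (λ i → F i j)) (F (suc n))))

sum-triangle : ∀ N (F : ℕ → ℕ → ℤ) →
  sumTo N (λ j → sumTo j (λ i → F i (j ∸ i))) ≡ sumTo N (λ i → sumTo (N ∸ i) (F i))
sum-triangle zero    F = refl
sum-triangle (suc N) F = begin
    sumTo N (λ j → sumTo j (λ i → F i (j ∸ i))) + sumTo (suc N) (λ i → F i (suc N ∸ i))
  ≡⟨ cong (_+ sumTo (suc N) (λ i → F i (suc N ∸ i))) (sum-triangle N F) ⟩
    S + (sumTo N (λ i → F i (suc N ∸ i)) + F (suc N) (N ∸ N))
  ≡⟨ cong (λ k → S + (sumTo N (λ i → F i (suc N ∸ i)) + F (suc N) k)) (ℕP.n∸n≡0 N) ⟩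
    S + (sumTo N (λ i → F i (suc N ∸ i)) + F (suc N) 0)
  ≡⟨ sym (ℤP.+-assoc S _ _) ⟩
    S + sumTo N (λ i → F i (suc N ∸ i)) + F (suc N) 0
  ≡⟨ cong (_+ F (suc N) 0) (sym (sum-+ N _ _)) ⟩
    sumTo N (λ i → sumTo (N ∸ i) (F i) + F i (suc N ∸ i)) + F (suc N) 0
  ≡⟨ cong (_+ F (suc N) 0) (sum-cong N extend) ⟩
    sumTo N (λ i → sumTo (suc N ∸ i) (F i)) + F (suc N) 0
  ≡⟨ cong (λ k → sumTo N (λ i → sumTo (suc N ∸ i) (F i)) + sumTo k (F (suc N))) (sym (ℕP.n∸n≡0 N)) ⟩
    sumTo (suc N) (λ i → sumTo (suc N ∸ i) (F i))
  ∎
  where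
  open ≡-Reasoning
  S : ℤ
  S = sumTo N (λ i → sumTo (N ∸ i) (F i))
  extend : ∀ i → i ℕ.≤ N → sumTo (N ∸ i) (F i) + F i (suc N ∸ i) ≡ sumTo (suc N ∸ i) (F i)
  extend i i≤N rewrite ℕP.+-∸-assoc 1 i≤N = refl

infix 4 _≋_
record _≋_ (a b : PS) : Set where
  constructor mk≋
  field at : ∀ n → a n ≡ b n
open _≋_ public

≋-refl : ∀ {a} → a ≋ a
≋-refl = mk≋ (λ n → refl)

≋-sym : ∀ {a b} → a ≋ b → b ≋ a
≋-sym (mk≋ a≡b) = mk≋ (λ n → sym (a≡b n))

≋-trans : ∀ {a b d} → a ≋ b → b ≋ d → a ≋ d
≋-trans (mk≋ a≡b) (mk≋ b≡d) = mk≋ (λ n → trans (a≡b n) (b≡d n))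

infixl 6 _⊕_
_⊕_ : PS → PS → PS
(a ⊕ b) n = a n + b n

zeroPS : PS
zeroPS n = 0ℤ

constPS : ℤ → PS
constPS k zero    = k
constPS k (suc _) = 0ℤ

⊕-cong : ∀ {a a′ b b′} → a ≋ a′ → b ≋ b′ → a ⊕ b ≋ a′ ⊕ b′
⊕-cong (mk≋ p) (mk≋ q) = mk≋ (λ n → cong₂ _+_ (p n) (q n))

neg-cong : ∀ {a a′} → a ≋ a′ → negPS a ≋ negPS a′
neg-cong (mk≋ p) = mk≋ (λ n → cong -_ (p n))

⊛-cong : ∀ {a a′ b b′} → a ≋ a′ → b ≋ b′ → a ⊛ b ≋ a′ ⊛ b′
⊛-cong (mk≋ p) (mk≋ q) = mk≋ (λ n → sum-cong′ n (λ i → cong₂ _*_ (p i) (q (n ∸ i))))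

⊛-comm : ∀ a b → a ⊛ b ≋ b ⊛ a
⊛-comm a b = mk≋ λ n → trans (sum-reverse n _) (sum-cong n (λ i i≤n →
  trans (ℤP.*-comm (a (n ∸ i)) (b (n ∸ (n ∸ i))))
        (cong (λ k → b k * a (n ∸ i)) (ℕP.m∸[m∸n]≡n i≤n))))

⊛-assoc : ∀ a b d → (a ⊛ b) ⊛ d ≋ a ⊛ (b ⊛ d)
⊛-assoc a b d = mk≋ λ n → begin
    sumTo n (λ j → sumTo j (λ i → a i * b (j ∸ i)) * d (n ∸ j))
  ≡⟨ sum-cong n (λ j j≤n → trans (sum-*ʳ j _ _) (sum-cong j (λ i i≤j →
       cong (λ k → a i * b (j ∸ i) * d (n ∸ k)) (sym (ℕP.m+[n∸m]≡n i≤j))))) ⟩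
    sumTo n (λ j → sumTo j (λ i → F n i (j ∸ i)))
  ≡⟨ sum-triangle n (F n) ⟩
    sumTo n (λ i → sumTo (n ∸ i) (F n i))
  ≡⟨ sum-cong′ n (λ i → trans (sum-cong′ (n ∸ i) (λ l → trans (ℤP.*-assoc (a i) (b l) _)
                                  (cong (λ k → a i * (b l * d k)) (sym (ℕP.∸-+-assoc n i l)))))
                              (sym (sum-*ˡ (n ∸ i) (a i) _))) ⟩
    sumTo n (λ i → a i * sumTo (n ∸ i) (λ l → b l * d (n ∸ i ∸ l)))
  ∎
  where
  open ≡-Reasoning
  F : ℕ → ℕ → ℕ → ℤ
  F n i l = a i * b l * d (n ∸ (i ℕ.+ l))

⊛-distribˡ : ∀ a b d → a ⊛ (b ⊕ d) ≋ a ⊛ b ⊕ a ⊛ d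
⊛-distribˡ a b d = mk≋ λ n →
  trans (sum-cong′ n (λ i → ℤP.*-distribˡ-+ (a i) (b (n ∸ i)) (d (n ∸ i)))) (sum-+ n _ _)

⊛-distribʳ : ∀ a b d → (b ⊕ d) ⊛ a ≋ b ⊛ a ⊕ d ⊛ a
⊛-distribʳ a b d = mk≋ λ n →
  trans (sum-cong′ n (λ i → ℤP.*-distribʳ-+ (a (n ∸ i)) (b i) (d i))) (sum-+ n _ _)

constPS-⊛ : ∀ k a n → (constPS k ⊛ a) n ≡ k * a n
constPS-⊛ k a zero    = refl
constPS-⊛ k a (suc n) = trans (sum-head n _)
  (trans (cong (λ s → k * a (suc n) + s) (sum-zero n _ (λ i _ → refl))) (ℤP.+-identityʳ _))

onePS≋constPS : onePS ≋ constPS 1ℤ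
onePS≋constPS = mk≋ λ { zero → refl ; (suc n) → refl }

⊛-identityˡ : ∀ a → onePS ⊛ a ≋ a
⊛-identityˡ a = mk≋ λ n → trans (at (⊛-cong onePS≋constPS (≋-refl {a})) n)
                               (trans (constPS-⊛ 1ℤ a n) (ℤP.*-identityˡ (a n)))

⊛-identityʳ : ∀ a → a ⊛ onePS ≋ a
⊛-identityʳ a = ≋-trans (⊛-comm a onePS) (⊛-identityˡ a)

⊕-assoc : ∀ a b d → a ⊕ b ⊕ d ≋ a ⊕ (b ⊕ d)
⊕-assoc a b d = mk≋ λ n → ℤP.+-assoc (a n) (b n) (d n)

PS-isCommutativeRing : IsCommutativeRing _≋_ _⊕_ _⊛_ negPS zeroPS onePS
PS-isCommutativeRing = record
  { isRing = record
    { +-isAbelianGroup = record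
      { isGroup = record
        { isMonoid = record
          { isSemigroup = record
            { isMagma = record
              { isEquivalence = record { refl = ≋-refl ; sym = ≋-sym ; trans = ≋-trans }
              ; ∙-cong = ⊕-cong }
            ; assoc = ⊕-assoc }
          ; identity = (λ a → mk≋ λ n → ℤP.+-identityˡ (a n)) , (λ a → mk≋ λ n → ℤP.+-identityʳ (a n)) }
        ; inverse = (λ a → mk≋ λ n → ℤP.+-inverseˡ (a n)) , (λ a → mk≋ λ n → ℤP.+-inverseʳ (a n))
        ; ⁻¹-cong = neg-cong }
      ; comm = λ a b → mk≋ λ n → ℤP.+-comm (a n) (b n) }
    ; *-cong = ⊛-cong
    ; *-assoc = ⊛-assoc
    ; *-identity = ⊛-identityˡ , ⊛-identityʳ
    ; distrib = ⊛-distribˡ , ⊛-distribʳ }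
  ; *-comm = ⊛-comm }

PS-commutativeRing : CommutativeRing _ _
PS-commutativeRing = record { isCommutativeRing = PS-isCommutativeRing }

-- Ring identities in ℤ[[x]] are proved by the ring solver, with integer
-- coefficients embedded through constPS.

PS-almostCommutativeRing : ACR.AlmostCommutativeRing _ _
PS-almostCommutativeRing = ACR.fromCommutativeRing PS-commutativeRing

constPS-morphism : CommutativeRing.rawRing ℤP.+-*-commutativeRing
                   ACR.-Raw-AlmostCommutative⟶ PS-almostCommutativeRing
constPS-morphism = record
  { ⟦_⟧    = constPS
  ; +-homo = λ a b → mk≋ λ { zero → refl ; (suc n) → refl }
  ; *-homo = λ a b → mk≋ λ n → sym (trans (constPS-⊛ a (constPS b) n) (product a b n))
  ; -‿homo = λ a → mk≋ λ { zero → refl ; (suc n) → refl }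
  ; 0-homo = mk≋ λ { zero → refl ; (suc n) → refl }
  ; 1-homo = ≋-sym onePS≋constPS }
  where
  product : ∀ a b n → a * constPS b n ≡ constPS (a * b) n
  product a b zero    = refl
  product a b (suc n) = ℤP.*-zeroʳ a

constPS-≟ : ∀ a b → Maybe (constPS a ≋ constPS b)
constPS-≟ a b with a ℤP.≟ b
... | yes refl = just ≋-refl
... | no _     = nothing

open Algebra.Solver.Ring (CommutativeRing.rawRing ℤP.+-*-commutativeRing)
       PS-almostCommutativeRing constPS-morphism constPS-≟
  using (solve; _:=_; con; _:+_; _:*_; :-_)

module ≋-Reasoning = Relation.Binary.Reasoning.Setoid (CommutativeRing.setoid PS-commutativeRing)

-- The series x, and 1 written as a constant series (as the ring solver writes it).
X : PS
X = xTimes onePS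

𝟙 : PS
𝟙 = constPS 1ℤ

X⊛ : ∀ a → X ⊛ a ≋ xTimes a
X⊛ a = mk≋ λ { zero    → refl
             ; (suc n) → trans (sum-head n _) (trans (ℤP.+-identityˡ _) (at (⊛-identityˡ a) n)) }

HasOrder : ℕ → PS → Set
HasOrder n a = ∀ m → m ℕ.< n → a m ≡ 0ℤ

X-order : HasOrder 1 X
X-order zero    _         = refl
X-order (suc m) (s≤s ())

order-⊕ : ∀ {n a b} → HasOrder n a → HasOrder n b → HasOrder n (a ⊕ b)
order-⊕ ha hb m m<n = cong₂ _+_ (ha m m<n) (hb m m<n)

order-⊛ˡ : ∀ {n a} b → HasOrder n a → HasOrder n (a ⊛ b)
order-⊛ˡ b ha m m<n = sum-zero m _ (λ i i≤m → cong (_* b (m ∸ i)) (ha i (ℕP.≤-<-trans i≤m m<n)))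

order-⊛ : ∀ {m n a b} → HasOrder m a → HasOrder n b → HasOrder (m ℕ.+ n) (a ⊛ b)
order-⊛ {m} {n} {a} {b} ha hb k k<m+n = sum-zero k _ term≡0
  where
  term≡0 : ∀ i → i ℕ.≤ k → a i * b (k ∸ i) ≡ 0ℤ
  term≡0 i i≤k with i ℕ.<? m
  ... | yes i<m = cong (_* b (k ∸ i)) (ha i i<m)
  ... | no  i≮m = trans (cong (a i *_) (hb (k ∸ i) k∸i<n)) (ℤP.*-zeroʳ (a i))
    where
    k∸i<n : k ∸ i ℕ.< n
    k∸i<n = subst (k ∸ i ℕ.<_) (ℕP.m+n∸m≡n i n)
              (ℕP.∸-monoˡ-< (ℕP.<-≤-trans k<m+n (ℕP.+-monoˡ-≤ n (ℕP.≮⇒≥ i≮m))) i≤k)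

order-pow : ∀ {h} → HasOrder 1 h → ∀ j → HasOrder j (h ^ᵖ j)
order-pow h₁ zero    = λ m ()
order-pow h₁ (suc j) = order-⊛ h₁ (order-pow h₁ j)

⊛-leading : ∀ {n a} b → HasOrder n a → (b ⊛ a) n ≡ b 0 * a n
⊛-leading {zero}      b ha = refl
⊛-leading {suc n} {a} b ha = trans (sum-head n _)
  (trans (cong (λ s → b 0 * a (suc n) + s) (sum-zero n _ higher≡0)) (ℤP.+-identityʳ _))
  where
  higher≡0 : ∀ i → i ℕ.≤ n → b (suc i) * a (n ∸ i) ≡ 0ℤ
  higher≡0 i _ = trans (cong (b (suc i) *_) (ha (n ∸ i) (s≤s (ℕP.m∸n≤m n i)))) (ℤP.*-zeroʳ (b (suc i)))

order-induction : ∀ a → (∀ n → HasOrder n a → a n ≡ 0ℤ) → a ≋ zeroPS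
order-induction a step = mk≋ λ n → step n (orderAll n)
  where
  orderAll : ∀ n → HasOrder n a
  orderAll (suc n) m m<1+n with ℕP.m<1+n⇒m<n∨m≡n m<1+n
  ... | inj₁ m<n  = orderAll n m m<n
  ... | inj₂ refl = step m (orderAll m)

pow-cong : ∀ {a a′} → a ≋ a′ → ∀ k → a ^ᵖ k ≋ a′ ^ᵖ k
pow-cong a≋a′ zero    = ≋-refl
pow-cong a≋a′ (suc k) = ⊛-cong a≋a′ (pow-cong a≋a′ k)

pow-+ : ∀ h i l → h ^ᵖ (i ℕ.+ l) ≋ (h ^ᵖ i) ⊛ (h ^ᵖ l)
pow-+ h zero    l = ≋-sym (⊛-identityˡ (h ^ᵖ l))
pow-+ h (suc i) l = ≋-trans (⊛-cong (≋-refl {h}) (pow-+ h i l)) (≋-sym (⊛-assoc h (h ^ᵖ i) (h ^ᵖ l)))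

sum-product : ∀ p q (f g : ℕ → ℤ) →
              sumTo p f * sumTo q g ≡ sumTo p (λ i → sumTo q (λ l → f i * g l))
sum-product p q f g = trans (sum-*ʳ p (sumTo q g) f) (sum-cong′ p (λ i → sum-*ˡ q (f i) g))

-- Composition a(h(x)) of power series.  When h has no constant term, hʲ has
-- order j, so only the terms j ≤ n contribute to the coefficient of xⁿ.

infixl 8 _∘ᵖ_
_∘ᵖ_ : PS → PS → PS
(a ∘ᵖ h) n = sumTo n (λ j → a j * (h ^ᵖ j) n)

∘-cong : ∀ {a a′} h → a ≋ a′ → a ∘ᵖ h ≋ a′ ∘ᵖ h
∘-cong h a≋a′ = mk≋ λ n → sum-cong′ n (λ j → cong (_* (h ^ᵖ j) n) (at a≋a′ j))

∘-⊕ : ∀ a b h → (a ⊕ b) ∘ᵖ h ≋ a ∘ᵖ h ⊕ b ∘ᵖ h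
∘-⊕ a b h = mk≋ λ n →
  trans (sum-cong′ n (λ j → ℤP.*-distribʳ-+ ((h ^ᵖ j) n) (a j) (b j))) (sum-+ n _ _)

∘-neg : ∀ a h → negPS a ∘ᵖ h ≋ negPS (a ∘ᵖ h)
∘-neg a h = mk≋ λ n →
  trans (sum-cong′ n (λ j → sym (ℤP.neg-distribˡ-* (a j) ((h ^ᵖ j) n)))) (sym (sum-neg n _))

∘-const : ∀ k h → constPS k ∘ᵖ h ≋ constPS k
∘-const k h = mk≋ λ
  { zero    → ℤP.*-identityʳ k
  ; (suc n) → trans (sum-truncate {n = suc n} (λ j → constPS k j * (h ^ᵖ j) (suc n)) z≤n
                       (λ { zero () _ ; (suc j) _ _ → refl }))
                     (ℤP.*-zeroʳ k) }

module Composition (h : PS) (h₁ : HasOrder 1 h) where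

  ∘-truncate : ∀ a {m N} → m ℕ.≤ N → (a ∘ᵖ h) m ≡ sumTo N (λ j → a j * (h ^ᵖ j) m)
  ∘-truncate a m≤N = sym (sum-truncate _ m≤N (λ j m<j _ →
    trans (cong (a j *_) (order-pow h₁ j _ m<j)) (ℤP.*-zeroʳ (a j))))

  ∘-X : X ∘ᵖ h ≋ h
  ∘-X = mk≋ λ
    { zero    → sym (h₁ 0 (s≤s z≤n))
    ; (suc n) → begin
        (X ∘ᵖ h) (suc n)
      ≡⟨ trans (sum-head n _) (ℤP.+-identityˡ _) ⟩
        sumTo n (λ j → onePS j * (h ^ᵖ suc j) (suc n))
      ≡⟨ sum-truncate {n = n} (λ j → onePS j * (h ^ᵖ suc j) (suc n)) z≤n (λ { zero () _ ; (suc j) _ _ → refl }) ⟩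
        1ℤ * (h ⊛ onePS) (suc n)
      ≡⟨ trans (ℤP.*-identityˡ _) (at (⊛-identityʳ h) (suc n)) ⟩
        h (suc n)
      ∎ }
    where open ≡-Reasoning

  -- Both sides of (ab)∘h = (a∘h)(b∘h) equal  Σ_{i ≤ n} Σ_{l ≤ n} aᵢ bₗ [xⁿ] h^{i+l}.
  productCoeff : PS → PS → ℕ → ℤ
  productCoeff a b n = sumTo n (λ i → sumTo n (λ l → a i * b l * (h ^ᵖ (i ℕ.+ l)) n))

  ∘-⊛-expand : ∀ a b n → ((a ⊛ b) ∘ᵖ h) n ≡ productCoeff a b n
  ∘-⊛-expand a b n = begin
      sumTo n (λ j → sumTo j (λ i → a i * b (j ∸ i)) * (h ^ᵖ j) n)
    ≡⟨ sum-cong n (λ j _ → trans (sum-*ʳ j _ _) (sum-cong j (λ i i≤j →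
          cong (λ k → a i * b (j ∸ i) * (h ^ᵖ k) n) (sym (ℕP.m+[n∸m]≡n i≤j))))) ⟩
      sumTo n (λ j → sumTo j (λ i → F i (j ∸ i)))
    ≡⟨ sum-triangle n F ⟩
      sumTo n (λ i → sumTo (n ∸ i) (F i))
    ≡⟨ sum-cong n (λ i i≤n → sym (sum-truncate (F i) (ℕP.m∸n≤m n i) (λ l n∸i<l _ →
          trans (cong (a i * b l *_) (order-pow h₁ (i ℕ.+ l) n (beyond i≤n n∸i<l)))
                (ℤP.*-zeroʳ (a i * b l))))) ⟩
      productCoeff a b n
    ∎
    where
    open ≡-Reasoning
    F : ℕ → ℕ → ℤ
    F i l = a i * b l * (h ^ᵖ (i ℕ.+ l)) n
    beyond : ∀ {i l} → i ℕ.≤ n → n ∸ i ℕ.< l → n ℕ.< i ℕ.+ l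
    beyond {i} i≤n n∸i<l = subst (ℕ._< i ℕ.+ _) (ℕP.m+[n∸m]≡n i≤n) (ℕP.+-monoʳ-< i n∸i<l)

  ⊛-∘-expand : ∀ a b n → ((a ∘ᵖ h) ⊛ (b ∘ᵖ h)) n ≡ productCoeff a b n
  ⊛-∘-expand a b n = begin
      sumTo n (λ m → (a ∘ᵖ h) m * (b ∘ᵖ h) (n ∸ m))
    ≡⟨ sum-cong n (λ m m≤n → cong₂ _*_ (∘-truncate a m≤n) (∘-truncate b (ℕP.m∸n≤m n m))) ⟩
      sumTo n (λ m → sumTo n (λ i → a i * P i m) * sumTo n (λ l → b l * P l (n ∸ m)))
    ≡⟨ sum-cong′ n (λ m → sum-product n n _ _) ⟩
      sumTo n (λ m → sumTo n (λ i → sumTo n (λ l → G m i l)))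
    ≡⟨ sum-swap n n _ ⟩
      sumTo n (λ i → sumTo n (λ m → sumTo n (λ l → G m i l)))
    ≡⟨ sum-cong′ n (λ i → sum-swap n n _) ⟩
      sumTo n (λ i → sumTo n (λ l → sumTo n (λ m → G m i l)))
    ≡⟨ sum-cong′ n (λ i → sum-cong′ n (λ l → sym (trans (cong (a i * b l *_) (at (pow-+ h i l) n))
          (trans (sum-*ˡ n (a i * b l) _) (sum-cong′ n (λ m → regroup (a i) (b l) (P i m) _)))))) ⟩
      productCoeff a b n
    ∎
    where
    open ≡-Reasoning
    P : ℕ → ℕ → ℤ
    P j = h ^ᵖ j
    G : ℕ → ℕ → ℕ → ℤ
    G m i l = a i * P i m * (b l * P l (n ∸ m))
    regroup : ∀ x y u v → x * y * (u * v) ≡ x * u * (y * v)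
    regroup = ℤ-Solver.solve-∀

  ∘-⊛ : ∀ a b → (a ⊛ b) ∘ᵖ h ≋ (a ∘ᵖ h) ⊛ (b ∘ᵖ h)
  ∘-⊛ a b = mk≋ λ n → trans (∘-⊛-expand a b n) (sym (⊛-∘-expand a b n))

  ∘-pow : ∀ a k → (a ^ᵖ k) ∘ᵖ h ≋ (a ∘ᵖ h) ^ᵖ k
  ∘-pow a zero    = ≋-trans (∘-cong h onePS≋constPS) (≋-trans (∘-const 1ℤ h) (≋-sym onePS≋constPS))
  ∘-pow a (suc k) = ≋-trans (∘-⊛ a (a ^ᵖ k)) (⊛-cong (≋-refl {a ∘ᵖ h}) (∘-pow a k))

  riordan-action : ∀ g b n → sumTo n (λ j → riordan g h n j * b j) ≡ (g ⊛ (b ∘ᵖ h)) n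
  riordan-action g b n = begin
      sumTo n (λ j → sumTo n (λ i → g i * P j (n ∸ i)) * b j)
    ≡⟨ sum-cong′ n (λ j → trans (sum-*ʳ n (b j) _) (sum-cong′ n (λ i → regroup (g i) (P j (n ∸ i)) (b j)))) ⟩
      sumTo n (λ j → sumTo n (λ i → g i * (b j * P j (n ∸ i))))
    ≡⟨ sum-swap n n _ ⟩
      sumTo n (λ i → sumTo n (λ j → g i * (b j * P j (n ∸ i))))
    ≡⟨ sum-cong n (λ i i≤n → trans (sym (sum-*ˡ n (g i) _)) (cong (g i *_) (sym (∘-truncate b (ℕP.m∸n≤m n i))))) ⟩
      (g ⊛ (b ∘ᵖ h)) n
    ∎
    where
    open ≡-Reasoning
    P : ℕ → PS
    P j = h ^ᵖ j
    regroup : ∀ x y z → x * y * z ≡ x * (z * y)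
    regroup = ℤ-Solver.solve-∀

riordan-cong : ∀ {g g′ f f′} → g ≋ g′ → f ≋ f′ → ∀ n k → riordan g f n k ≡ riordan g′ f′ n k
riordan-cong g≋g′ f≋f′ n k = at (⊛-cong g≋g′ (pow-cong f≋f′ k)) n

riordan-product : ∀ g h G F → HasOrder 1 h → ∀ n k →
  matMul (riordan g h) (riordan G F) n k ≡ riordan (g ⊛ (G ∘ᵖ h)) (F ∘ᵖ h) n k
riordan-product g h G F h₁ n k = begin
    sumTo n (λ j → riordan g h n j * (G ⊛ (F ^ᵖ k)) j)
  ≡⟨ riordan-action g (G ⊛ (F ^ᵖ k)) n ⟩
    (g ⊛ ((G ⊛ (F ^ᵖ k)) ∘ᵖ h)) n
  ≡⟨ at (⊛-cong (≋-refl {g}) (≋-trans (∘-⊛ G (F ^ᵖ k)) (⊛-cong (≋-refl {G ∘ᵖ h}) (∘-pow F k)))) n ⟩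
    (g ⊛ ((G ∘ᵖ h) ⊛ ((F ∘ᵖ h) ^ᵖ k))) n
  ≡⟨ sym (at (⊛-assoc g (G ∘ᵖ h) ((F ∘ᵖ h) ^ᵖ k)) n) ⟩
    riordan (g ⊛ (G ∘ᵖ h)) (F ∘ᵖ h) n k
  ∎
  where
  open ≡-Reasoning
  open Composition h h₁

-- The equation z = 1 + y·z² has at most one solution when y has no constant
-- term: the difference d = z - w satisfies d = y·d·(z + w), so its order grows.
quadratic-unique : ∀ {y z w} → HasOrder 1 y →
  z ≋ 𝟙 ⊕ y ⊛ (z ⊛ z) → w ≋ 𝟙 ⊕ y ⊛ (w ⊛ w) → z ≋ w
quadratic-unique {y} {z} {w} y₁ z-eq w-eq = mk≋ λ n → ℤP.i-j≡0⇒i≡j (z n) (w n) (at d≋0 n)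
  where
  d : PS
  d = z ⊕ negPS w
  difference : ∀ y z w → 𝟙 ⊕ y ⊛ (z ⊛ z) ⊕ negPS (𝟙 ⊕ y ⊛ (w ⊛ w)) ≋ y ⊛ ((z ⊕ negPS w) ⊛ (z ⊕ w))
  difference = solve 3 (λ y z w → con 1ℤ :+ y :* (z :* z) :+ :- (con 1ℤ :+ y :* (w :* w))
                                  := y :* ((z :+ :- w) :* (z :+ w))) ≋-refl
  d-eq : d ≋ y ⊛ (d ⊛ (z ⊕ w))
  d-eq = ≋-trans (⊕-cong z-eq (neg-cong w-eq)) (difference y z w)
  d≋0 : d ≋ zeroPS
  d≋0 = order-induction d (λ n dₙ →
    trans (at d-eq n) (order-⊛ y₁ (order-⊛ˡ (z ⊕ w) dₙ) n ℕP.≤-refl))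

binomial-factorials : ∀ {m k} → k ℕ.≤ m → (m C k) ℕ.* (k ! ℕ.* (m ∸ k) !) ≡ m !
binomial-factorials {m} {k} k≤m =
  trans (cong (ℕ._* (k ! ℕ.* (m ∸ k) !)) (nCk≡n!/k![n-k]! k≤m))
        (m/n*n≡m {{ℕP._!*_!≢0 k (m ∸ k)}} (k![n∸k]!∣n! k≤m))

binomial-succ : ∀ {m k} → k ℕ.< m → suc k ℕ.* (m C suc k) ≡ (m ∸ k) ℕ.* (m C k)
binomial-succ {m} {k} k<m =
  ℕP.*-cancelʳ-≡ _ _ (k ! ℕ.* (m ∸ suc k) !) {{ℕP._!*_!≢0 k (m ∸ suc k)}} (begin
    suc k ℕ.* (m C suc k) ℕ.* (k ! ℕ.* (m ∸ suc k) !)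
  ≡⟨ regroup₁ (suc k) (m C suc k) (k !) ((m ∸ suc k) !) ⟩
    (m C suc k) ℕ.* (suc k ! ℕ.* (m ∸ suc k) !)
  ≡⟨ binomial-factorials k<m ⟩
    m !
  ≡⟨ sym (binomial-factorials (ℕP.<⇒≤ k<m)) ⟩
    (m C k) ℕ.* (k ! ℕ.* (m ∸ k) !)
  ≡⟨ cong (λ t → (m C k) ℕ.* (k ! ℕ.* t)) (sym ([n-k]*[n-k-1]!≡[n-k]! k<m)) ⟩
    (m C k) ℕ.* (k ! ℕ.* ((m ∸ k) ℕ.* (m ∸ suc k) !))
  ≡⟨ regroup₂ (m ∸ k) (m C k) (k !) ((m ∸ suc k) !) ⟩
    (m ∸ k) ℕ.* (m C k) ℕ.* (k ! ℕ.* (m ∸ suc k) !)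
  ∎)
  where
  open ≡-Reasoning
  regroup₁ : ∀ a b c d → a ℕ.* b ℕ.* (c ℕ.* d) ≡ b ℕ.* (a ℕ.* c ℕ.* d)
  regroup₁ = ℕ-Solver.solve-∀
  regroup₂ : ∀ a b c d → b ℕ.* (c ℕ.* (a ℕ.* d)) ≡ a ℕ.* b ℕ.* (c ℕ.* d)
  regroup₂ = ℕ-Solver.solve-∀

centralBinomial : ℕ → ℕ
centralBinomial n = (2 ℕ.* n) C n

2n∸n≡n : ∀ n → 2 ℕ.* n ∸ n ≡ n
2n∸n≡n n = trans (ℕP.m+n∸m≡n n (n ℕ.+ 0)) (ℕP.+-identityʳ n)

central-neighbour : ∀ n → suc n ℕ.* ((2 ℕ.* n) C suc n) ≡ n ℕ.* centralBinomial n
central-neighbour zero        = refl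
central-neighbour n@(suc _) =
  trans (binomial-succ (ℕP.m<m+n n ℕ.z<s)) (cong (ℕ._* centralBinomial n) (2n∸n≡n n))

-- The division defining Cₙ is exact: Cₙ·(n+1) = binom(2n, n), since
-- Cₙ = binom(2n, n) - binom(2n, n+1).
catalan-exact : ∀ n → catalan n ℕ.* suc n ≡ centralBinomial n
catalan-exact n = trans (cong (ℕ._* suc n) catalan≡difference) difference-exact
  where
  B B′ : ℕ
  B  = centralBinomial n
  B′ = (2 ℕ.* n) C suc n
  difference-exact : (B ∸ B′) ℕ.* suc n ≡ B
  difference-exact = begin
      (B ∸ B′) ℕ.* suc n
    ≡⟨ ℕP.*-distribʳ-∸ (suc n) B B′ ⟩
      B ℕ.* suc n ∸ B′ ℕ.* suc n
    ≡⟨ cong₂ _∸_ (ℕP.*-suc B n) (trans (ℕP.*-comm B′ (suc n)) (trans (central-neighbour n) (ℕP.*-comm n B))) ⟩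
      B ℕ.+ B ℕ.* n ∸ B ℕ.* n
    ≡⟨ ℕP.m+n∸n≡m B (B ℕ.* n) ⟩
      B
    ∎
    where open ≡-Reasoning
  catalan≡difference : catalan n ≡ B ∸ B′
  catalan≡difference = trans (cong (_/ suc n) (sym difference-exact)) (m*n/n≡m (B ∸ B′) (suc n))

-- binom(2n+2, n+1) = 2·(binom(2n, n) + binom(2n, n+1)), by Pascal's rule and symmetry.
central-succ : ∀ n → centralBinomial (suc n) ≡ 2 ℕ.* (centralBinomial n ℕ.+ (2 ℕ.* n) C suc n)
central-succ n = begin
    (2 ℕ.* suc n) C suc n
  ≡⟨ cong (_C suc n) (ℕP.*-suc 2 n) ⟩
    suc (suc m) C suc n
  ≡⟨ sym (nCk+nC[k+1]≡[n+1]C[k+1] (suc m) n) ⟩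
    (suc m C n) ℕ.+ (suc m C suc n)
  ≡⟨ cong (ℕ._+ (suc m C suc n)) symmetric ⟩
    (suc m C suc n) ℕ.+ (suc m C suc n)
  ≡⟨ cong (λ t → t ℕ.+ t) (sym (nCk+nC[k+1]≡[n+1]C[k+1] m n)) ⟩
    (m C n ℕ.+ m C suc n) ℕ.+ (m C n ℕ.+ m C suc n)
  ≡⟨ cong ((m C n ℕ.+ m C suc n) ℕ.+_) (sym (ℕP.+-identityʳ _)) ⟩
    2 ℕ.* (m C n ℕ.+ m C suc n)
  ∎
  where
  open ≡-Reasoning
  m : ℕ
  m = 2 ℕ.* n
  n≤m : n ℕ.≤ m
  n≤m = ℕP.m≤m+n n (n ℕ.+ 0)
  symmetric : suc m C n ≡ suc m C suc n
  symmetric = trans (nCk≡nC[n∸k] (ℕP.m≤n⇒m≤1+n n≤m))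
                    (cong (suc m C_) (trans (ℕP.+-∸-assoc 1 n≤m) (cong suc (2n∸n≡n n))))

catalan-recurrence : ∀ n → suc (suc n) ℕ.* catalan (suc n) ≡ (4 ℕ.* n ℕ.+ 2) ℕ.* catalan n
catalan-recurrence n = ℕP.*-cancelʳ-≡ _ _ (suc n) (begin
    suc (suc n) ℕ.* catalan (suc n) ℕ.* suc n
  ≡⟨ regroup (suc (suc n)) (catalan (suc n)) (suc n) ⟩
    suc n ℕ.* (catalan (suc n) ℕ.* suc (suc n))
  ≡⟨ cong (suc n ℕ.*_) (trans (catalan-exact (suc n)) (central-succ n)) ⟩
    suc n ℕ.* (2 ℕ.* (B ℕ.+ B′))
  ≡⟨ distribute (suc n) B B′ ⟩
    2 ℕ.* (suc n ℕ.* B) ℕ.+ 2 ℕ.* (suc n ℕ.* B′)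
  ≡⟨ cong (λ t → 2 ℕ.* (suc n ℕ.* B) ℕ.+ 2 ℕ.* t) (central-neighbour n) ⟩
    2 ℕ.* (suc n ℕ.* B) ℕ.+ 2 ℕ.* (n ℕ.* B)
  ≡⟨ collect n B ⟩
    (4 ℕ.* n ℕ.+ 2) ℕ.* B
  ≡⟨ cong ((4 ℕ.* n ℕ.+ 2) ℕ.*_) (sym (catalan-exact n)) ⟩
    (4 ℕ.* n ℕ.+ 2) ℕ.* (catalan n ℕ.* suc n)
  ≡⟨ sym (ℕP.*-assoc (4 ℕ.* n ℕ.+ 2) (catalan n) (suc n)) ⟩
    (4 ℕ.* n ℕ.+ 2) ℕ.* catalan n ℕ.* suc n
  ∎)
  where
  open ≡-Reasoning
  B B′ : ℕ
  B  = centralBinomial n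
  B′ = (2 ℕ.* n) C suc n
  regroup : ∀ a b d → a ℕ.* b ℕ.* d ≡ d ℕ.* (b ℕ.* a)
  regroup = ℕ-Solver.solve-∀
  distribute : ∀ a b d → a ℕ.* (2 ℕ.* (b ℕ.+ d)) ≡ 2 ℕ.* (a ℕ.* b) ℕ.+ 2 ℕ.* (a ℕ.* d)
  distribute = ℕ-Solver.solve-∀
  collect : ∀ n b → 2 ℕ.* (suc n ℕ.* b) ℕ.+ 2 ℕ.* (n ℕ.* b) ≡ (4 ℕ.* n ℕ.+ 2) ℕ.* b
  collect = ℕ-Solver.solve-∀

-- The Euler operator θ = x·d/dx, a derivation of ℤ[[x]].

θ : PS → PS
θ a n = + n * a n

θ-⊕ : ∀ a b → θ (a ⊕ b) ≋ θ a ⊕ θ b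
θ-⊕ a b = mk≋ λ n → ℤP.*-distribˡ-+ (+ n) (a n) (b n)

θ-neg : ∀ a → θ (negPS a) ≋ negPS (θ a)
θ-neg a = mk≋ λ n → sym (ℤP.neg-distribʳ-* (+ n) (a n))

θ-const : ∀ k → θ (constPS k) ≋ constPS 0ℤ
θ-const k = mk≋ λ { zero → refl ; (suc n) → ℤP.*-zeroʳ (+ suc n) }

θ-X : θ X ≋ X
θ-X = mk≋ λ { zero → refl ; (suc zero) → refl ; (suc (suc n)) → ℤP.*-zeroʳ (+ suc (suc n)) }

θ-⊛ : ∀ a b → θ (a ⊛ b) ≋ θ a ⊛ b ⊕ a ⊛ θ b
θ-⊛ a b = mk≋ λ n → trans (sum-*ˡ n (+ n) _) (trans (sum-cong n (split n)) (sum-+ n _ _))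
  where
  split : ∀ n i → i ℕ.≤ n →
          + n * (a i * b (n ∸ i)) ≡ + i * a i * b (n ∸ i) + a i * (+ (n ∸ i) * b (n ∸ i))
  split n i i≤n = begin
      + n * (a i * b (n ∸ i))
    ≡⟨ cong (λ k → + k * (a i * b (n ∸ i))) (sym (ℕP.m+[n∸m]≡n i≤n)) ⟩
      + (i ℕ.+ (n ∸ i)) * (a i * b (n ∸ i))
    ≡⟨ cong (_* (a i * b (n ∸ i))) (ℤP.pos-+ i (n ∸ i)) ⟩
      (+ i + + (n ∸ i)) * (a i * b (n ∸ i))
    ≡⟨ distribute (+ i) (+ (n ∸ i)) (a i) (b (n ∸ i)) ⟩
      + i * a i * b (n ∸ i) + a i * (+ (n ∸ i) * b (n ∸ i))
    ∎
    where
    open ≡-Reasoning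
    distribute : ∀ p q x y → (p + q) * (x * y) ≡ p * x * y + x * (q * y)
    distribute = ℤ-Solver.solve-∀

θ-order : ∀ {n a} → HasOrder n a → HasOrder n (θ a)
θ-order ha m m<n = trans (cong (+ m *_) (ha m m<n)) (ℤP.*-zeroʳ (+ m))

-- The Catalan recurrence, read as a differential equation for c:
--   θc + c = 1 + x·(4·θc + 2·c).
catalan-ode : θ c ⊕ c ≋ 𝟙 ⊕ X ⊛ (constPS (+ 4) ⊛ θ c ⊕ constPS (+ 2) ⊛ c)
catalan-ode = mk≋ λ
  { zero    → refl
  ; (suc n) → begin
      + suc n * c (suc n) + c (suc n)
    ≡⟨ collect (+ suc n) (c (suc n)) ⟩
      + suc (suc n) * c (suc n)
    ≡⟨ recurrence n ⟩
      (+ 4 * + n + + 2) * c n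
    ≡⟨ distribute (+ n) (c n) ⟩
      + 4 * θ c n + + 2 * c n
    ≡⟨ sym (cong₂ _+_ (constPS-⊛ (+ 4) (θ c) n) (constPS-⊛ (+ 2) c n)) ⟩
      (constPS (+ 4) ⊛ θ c ⊕ constPS (+ 2) ⊛ c) n
    ≡⟨ sym (trans (ℤP.+-identityˡ _) (at (X⊛ (constPS (+ 4) ⊛ θ c ⊕ constPS (+ 2) ⊛ c)) (suc n))) ⟩
      (𝟙 ⊕ X ⊛ (constPS (+ 4) ⊛ θ c ⊕ constPS (+ 2) ⊛ c)) (suc n)
    ∎ }
  where
  open ≡-Reasoning
  recurrence : ∀ n → + suc (suc n) * c (suc n) ≡ (+ 4 * + n + + 2) * c n
  recurrence n = begin
      + suc (suc n) * + catalan (suc n)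
    ≡⟨ sym (ℤP.pos-* (suc (suc n)) (catalan (suc n))) ⟩
      + (suc (suc n) ℕ.* catalan (suc n))
    ≡⟨ cong +_ (catalan-recurrence n) ⟩
      + ((4 ℕ.* n ℕ.+ 2) ℕ.* catalan n)
    ≡⟨ ℤP.pos-* (4 ℕ.* n ℕ.+ 2) (catalan n) ⟩
      + (4 ℕ.* n ℕ.+ 2) * + catalan n
    ≡⟨ cong (_* c n) (trans (ℤP.pos-+ (4 ℕ.* n) 2) (cong (_+ + 2) (ℤP.pos-* 4 n))) ⟩
      (+ 4 * + n + + 2) * + catalan n
    ∎
  collect : ∀ N a → N * a + a ≡ (1ℤ + N) * a
  collect = ℤ-Solver.solve-∀
  distribute : ∀ N b → (+ 4 * N + + 2) * b ≡ + 4 * (N * b) + + 2 * b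
  distribute = ℤ-Solver.solve-∀

catalanDefect : PS
catalanDefect = c ⊕ negPS (𝟙 ⊕ X ⊛ (c ⊛ c))

θ-defect : θ catalanDefect ≋ θ c ⊕ negPS (constPS 0ℤ ⊕ (X ⊛ (c ⊛ c) ⊕ X ⊛ (θ c ⊛ c ⊕ c ⊛ θ c)))
θ-defect = begin
    θ (c ⊕ negPS (𝟙 ⊕ X ⊛ (c ⊛ c)))
  ≈⟨ θ-⊕ c _ ⟩
    θ c ⊕ θ (negPS (𝟙 ⊕ X ⊛ (c ⊛ c)))
  ≈⟨ ⊕-cong (≋-refl {θ c}) (θ-neg _) ⟩
    θ c ⊕ negPS (θ (𝟙 ⊕ X ⊛ (c ⊛ c)))
  ≈⟨ ⊕-cong (≋-refl {θ c}) (neg-cong (≋-trans (θ-⊕ 𝟙 _) (⊕-cong (θ-const 1ℤ) (θ-⊛ X (c ⊛ c))))) ⟩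
    θ c ⊕ negPS (constPS 0ℤ ⊕ (θ X ⊛ (c ⊛ c) ⊕ X ⊛ θ (c ⊛ c)))
  ≈⟨ ⊕-cong (≋-refl {θ c}) (neg-cong (⊕-cong (≋-refl {constPS 0ℤ})
       (⊕-cong (⊛-cong θ-X (≋-refl {c ⊛ c})) (⊛-cong (≋-refl {X}) (θ-⊛ c c))))) ⟩
    θ c ⊕ negPS (constPS 0ℤ ⊕ (X ⊛ (c ⊛ c) ⊕ X ⊛ (θ c ⊛ c ⊕ c ⊛ θ c)))
  ∎
  where open ≋-Reasoning

-- Substituting c = E + 1 + x·c² into the differential equation expresses it
-- through the defect:  0 = (1 - 2xc)·(θE + E) + x·E·4(θc + c).
defect-equation : zeroPS ≋ (𝟙 ⊕ negPS (constPS (+ 2) ⊛ X ⊛ c)) ⊛ (θ catalanDefect ⊕ catalanDefect)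
                          ⊕ X ⊛ catalanDefect ⊛ (constPS (+ 4) ⊛ (θ c ⊕ c))
defect-equation = begin
    zeroPS
  ≈⟨ mk≋ (λ n → sym (trans (cong (_+ - rhs n) (at catalan-ode n)) (ℤP.+-inverseʳ (rhs n)))) ⟩
    θ c ⊕ c ⊕ negPS rhs
  ≈⟨ regroup c (θ c) X ⟩
    (𝟙 ⊕ negPS (constPS (+ 2) ⊛ X ⊛ c)) ⊛ (θE ⊕ catalanDefect)
      ⊕ X ⊛ catalanDefect ⊛ (constPS (+ 4) ⊛ (θ c ⊕ c))
  ≈⟨ ⊕-cong (⊛-cong (≋-refl {𝟙 ⊕ negPS (constPS (+ 2) ⊛ X ⊛ c)})
                    (⊕-cong (≋-sym θ-defect) (≋-refl {catalanDefect})))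
            (≋-refl {X ⊛ catalanDefect ⊛ (constPS (+ 4) ⊛ (θ c ⊕ c))}) ⟩
    (𝟙 ⊕ negPS (constPS (+ 2) ⊛ X ⊛ c)) ⊛ (θ catalanDefect ⊕ catalanDefect)
      ⊕ X ⊛ catalanDefect ⊛ (constPS (+ 4) ⊛ (θ c ⊕ c))
  ∎
  where
  open ≋-Reasoning
  rhs θE : PS
  rhs = 𝟙 ⊕ X ⊛ (constPS (+ 4) ⊛ θ c ⊕ constPS (+ 2) ⊛ c)
  θE  = θ c ⊕ negPS (constPS 0ℤ ⊕ (X ⊛ (c ⊛ c) ⊕ X ⊛ (θ c ⊛ c ⊕ c ⊛ θ c)))
  regroup : ∀ c T X →
    T ⊕ c ⊕ negPS (𝟙 ⊕ X ⊛ (constPS (+ 4) ⊛ T ⊕ constPS (+ 2) ⊛ c))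
    ≋ (𝟙 ⊕ negPS (constPS (+ 2) ⊛ X ⊛ c))
        ⊛ (T ⊕ negPS (constPS 0ℤ ⊕ (X ⊛ (c ⊛ c) ⊕ X ⊛ (T ⊛ c ⊕ c ⊛ T))) ⊕ (c ⊕ negPS (𝟙 ⊕ X ⊛ (c ⊛ c))))
      ⊕ X ⊛ (c ⊕ negPS (𝟙 ⊕ X ⊛ (c ⊛ c))) ⊛ (constPS (+ 4) ⊛ (T ⊕ c))
  regroup = solve 3 (λ c T X →
      T :+ c :+ :- (con 1ℤ :+ X :* (con (+ 4) :* T :+ con (+ 2) :* c))
    := (con 1ℤ :+ :- (con (+ 2) :* X :* c))
         :* (T :+ :- (con 0ℤ :+ (X :* (c :* c) :+ X :* (T :* c :+ c :* T))) :+ (c :+ :- (con 1ℤ :+ X :* (c :* c))))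
       :+ X :* (c :+ :- (con 1ℤ :+ X :* (c :* c))) :* (con (+ 4) :* (T :+ c))) ≋-refl

-- The defect vanishes coefficient by coefficient: if E has order n+1, the
-- coefficient of x^{n+1} in the defect equation is (n+2)·E_{n+1}.
defect-step : ∀ n → HasOrder n catalanDefect → catalanDefect n ≡ 0ℤ
defect-step zero    _  = refl
defect-step (suc n) Eₙ = ℤP.*-cancelˡ-≡ (+ suc (suc n)) e 0ℤ (begin
    + suc (suc n) * e
  ≡⟨ collect (+ suc n) e ⟩
    s 0 * (θ E ⊕ E) (suc n)
  ≡⟨ sym (⊛-leading s (order-⊕ (θ-order Eₙ) Eₙ)) ⟩
    (s ⊛ (θ E ⊕ E)) (suc n)
  ≡⟨ sym (trans (cong (λ t → (s ⊛ (θ E ⊕ E)) (suc n) + t) (order-⊛ˡ K (order-⊛ X-order Eₙ) (suc n) ℕP.≤-refl))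
                (ℤP.+-identityʳ _)) ⟩
    (s ⊛ (θ E ⊕ E) ⊕ X ⊛ E ⊛ K) (suc n)
  ≡⟨ sym (at defect-equation (suc n)) ⟩
    0ℤ
  ≡⟨ sym (ℤP.*-zeroʳ (+ suc (suc n))) ⟩
    + suc (suc n) * 0ℤ
  ∎)
  where
  open ≡-Reasoning
  E s K : PS
  E = catalanDefect
  s = 𝟙 ⊕ negPS (constPS (+ 2) ⊛ X ⊛ c)
  K = constPS (+ 4) ⊛ (θ c ⊕ c)
  e : ℤ
  e = E (suc n)
  collect : ∀ N x → (1ℤ + N) * x ≡ 1ℤ * (N * x + x)
  collect = ℤ-Solver.solve-∀

catalan-equation : c ≋ 𝟙 ⊕ X ⊛ (c ⊛ c)
catalan-equation = mk≋ λ n →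
  ℤP.i-j≡0⇒i≡j (c n) _ (at (order-induction catalanDefect defect-step) n)

w : PS
w = 𝟙 ⊕ negPS (X ⊛ c)

c⊛w≋𝟙 : c ⊛ w ≋ 𝟙
c⊛w≋𝟙 = begin
    c ⊛ (𝟙 ⊕ negPS (X ⊛ c))
  ≈⟨ solve 2 (λ c X → c :* (con 1ℤ :+ :- (X :* c)) := c :+ :- (X :* (c :* c))) ≋-refl c X ⟩
    c ⊕ negPS (X ⊛ (c ⊛ c))
  ≈⟨ ⊕-cong catalan-equation (≋-refl {negPS (X ⊛ (c ⊛ c))}) ⟩
    𝟙 ⊕ X ⊛ (c ⊛ c) ⊕ negPS (X ⊛ (c ⊛ c))
  ≈⟨ solve 2 (λ u v → u :+ v :+ :- v := u) ≋-refl 𝟙 (X ⊛ (c ⊛ c)) ⟩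
    𝟙
  ∎
  where open ≋-Reasoning

fC≋-xc³ : fC ≋ negPS (X ⊛ (c ⊛ c ⊛ c))
fC≋-xc³ = neg-cong (≋-sym (X⊛ (c ⊛ c ⊛ c)))

fC-order : HasOrder 1 fC
fC-order zero    _         = refl
fC-order (suc m) (s≤s ())

open Composition fC fC-order

-- c(f) = 1 - x·c: both sides solve z = 1 + f·z².
c∘f≋w : c ∘ᵖ fC ≋ w
c∘f≋w = quadratic-unique fC-order c∘f-equation w-equation
  where
  c∘f-equation : c ∘ᵖ fC ≋ 𝟙 ⊕ fC ⊛ ((c ∘ᵖ fC) ⊛ (c ∘ᵖ fC))
  c∘f-equation = begin
      c ∘ᵖ fC
    ≈⟨ ∘-cong fC catalan-equation ⟩
      (𝟙 ⊕ X ⊛ (c ⊛ c)) ∘ᵖ fC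
    ≈⟨ ∘-⊕ 𝟙 (X ⊛ (c ⊛ c)) fC ⟩
      𝟙 ∘ᵖ fC ⊕ (X ⊛ (c ⊛ c)) ∘ᵖ fC
    ≈⟨ ⊕-cong (∘-const 1ℤ fC) (≋-trans (∘-⊛ X (c ⊛ c)) (⊛-cong ∘-X (∘-⊛ c c))) ⟩
      𝟙 ⊕ fC ⊛ ((c ∘ᵖ fC) ⊛ (c ∘ᵖ fC))
    ∎
    where open ≋-Reasoning
  w-equation : w ≋ 𝟙 ⊕ fC ⊛ (w ⊛ w)
  w-equation = ≋-sym (begin
      𝟙 ⊕ fC ⊛ (w ⊛ w)
    ≈⟨ ⊕-cong (≋-refl {𝟙}) (⊛-cong fC≋-xc³ (≋-refl {w ⊛ w})) ⟩
      𝟙 ⊕ negPS (X ⊛ (c ⊛ c ⊛ c)) ⊛ (w ⊛ w)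
    ≈⟨ solve 3 (λ c X w → con 1ℤ :+ :- (X :* (c :* c :* c)) :* (w :* w)
                       := con 1ℤ :+ :- (X :* c :* ((c :* w) :* (c :* w)))) ≋-refl c X w ⟩
      𝟙 ⊕ negPS (X ⊛ c ⊛ ((c ⊛ w) ⊛ (c ⊛ w)))
    ≈⟨ ⊕-cong (≋-refl {𝟙}) (neg-cong (⊛-cong (≋-refl {X ⊛ c}) (⊛-cong c⊛w≋𝟙 c⊛w≋𝟙))) ⟩
      𝟙 ⊕ negPS (X ⊛ c ⊛ (𝟙 ⊛ 𝟙))
    ≈⟨ solve 2 (λ c X → con 1ℤ :+ :- (X :* c :* (con 1ℤ :* con 1ℤ))
                     := con 1ℤ :+ :- (X :* c)) ≋-refl c X ⟩
      w
    ∎)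
    where open ≋-Reasoning

-- f(f) = x:  f(f) = -f·c(f)³ = x·c³·w³ = x·(c·w)³.
f∘f≋X : fC ∘ᵖ fC ≋ X
f∘f≋X = begin
    fC ∘ᵖ fC
  ≈⟨ ≋-trans (∘-cong fC fC≋-xc³) (∘-neg (X ⊛ (c ⊛ c ⊛ c)) fC) ⟩
    negPS ((X ⊛ (c ⊛ c ⊛ c)) ∘ᵖ fC)
  ≈⟨ neg-cong (≋-trans (∘-⊛ X (c ⊛ c ⊛ c))
       (⊛-cong ∘-X (≋-trans (∘-⊛ (c ⊛ c) c) (⊛-cong (∘-⊛ c c) (≋-refl {c ∘ᵖ fC}))))) ⟩
    negPS (fC ⊛ ((c ∘ᵖ fC) ⊛ (c ∘ᵖ fC) ⊛ (c ∘ᵖ fC)))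
  ≈⟨ neg-cong (⊛-cong fC≋-xc³ (⊛-cong (⊛-cong c∘f≋w c∘f≋w) c∘f≋w)) ⟩
    negPS (negPS (X ⊛ (c ⊛ c ⊛ c)) ⊛ (w ⊛ w ⊛ w))
  ≈⟨ solve 3 (λ c X w → :- (:- (X :* (c :* c :* c)) :* (w :* w :* w))
                     := X :* ((c :* w) :* (c :* w) :* (c :* w))) ≋-refl c X w ⟩
    X ⊛ ((c ⊛ w) ⊛ (c ⊛ w) ⊛ (c ⊛ w))
  ≈⟨ ⊛-cong (≋-refl {X}) (⊛-cong (⊛-cong c⊛w≋𝟙 c⊛w≋𝟙) c⊛w≋𝟙) ⟩
    X ⊛ (𝟙 ⊛ 𝟙 ⊛ 𝟙)
  ≈⟨ solve 1 (λ X → X :* (con 1ℤ :* con 1ℤ :* con 1ℤ) := X) ≋-refl X ⟩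
    X
  ∎
  where open ≋-Reasoning

-- g·g(f) = 1:  c²·c(f)² = (c·w)².
g⊛g∘f≋1 : gC ⊛ (gC ∘ᵖ fC) ≋ onePS
g⊛g∘f≋1 = begin
    gC ⊛ ((c ⊛ c) ∘ᵖ fC)
  ≈⟨ ⊛-cong (≋-refl {gC}) (≋-trans (∘-⊛ c c) (⊛-cong c∘f≋w c∘f≋w)) ⟩
    c ⊛ c ⊛ (w ⊛ w)
  ≈⟨ solve 2 (λ c w → c :* c :* (w :* w) := (c :* w) :* (c :* w)) ≋-refl c w ⟩
    (c ⊛ w) ⊛ (c ⊛ w)
  ≈⟨ ⊛-cong c⊛w≋𝟙 c⊛w≋𝟙 ⟩
    𝟙 ⊛ 𝟙
  ≈⟨ solve 0 (con 1ℤ :* con 1ℤ := con 1ℤ) ≋-refl ⟩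
    𝟙
  ≈⟨ ≋-sym onePS≋constPS ⟩
    onePS
  ∎
  where open ≋-Reasoning

mainTheorem2 : ∀ (n k : ℕ) → matMul R R n k ≡ riordan onePS (xTimes onePS) n k
mainTheorem2 n k = begin
    matMul R R n k
  ≡⟨ riordan-product gC fC gC fC fC-order n k ⟩
    riordan (gC ⊛ (gC ∘ᵖ fC)) (fC ∘ᵖ fC) n k
  ≡⟨ riordan-cong g⊛g∘f≋1 f∘f≋X n k ⟩
    riordan onePS X n k
  ∎
  where open ≡-Reasoning
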